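{- Let $p$ be a prime, $m>0$ an integer, and $n$ an integer with $0<p^m<n$. Then \[ \mathcal{N}_n(p^m)=\left\lceil (n-p^m)\left(1-\frac{1}{p}\right)\right\rceil . \]
   Context: For a positive integer $n$, the Farey sequence $F_n$ is the set of irreducible fractions $a/b$ with $0<a/b\leq 1$ and $1\leq b\leq n$ (the fraction $0/1$ is excluded, $1/1$ is included). $\mathcal{N}_n(h)$ denotes the number of fractions in $F_n$ whose (reduced) numerator equals $h$. -}

module Defs where

open import Data.Nat using (ℕ; suc; _≤?_; _≟_)
open import Data.Nat.GCD using (gcd)
open import Data.List using (List; length; filter; applyUpTo; concatMap; map)
open import Data.Product using (_×_; _,_; proj₁)
open import Relation.Nullary.Decidable using (_×-dec_)

range1 : ℕ → List ℕ
range1 k = applyUpTo suc k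

-- The Farey sequence F_n, represented as the list of pairs (a , b) with
-- 1 ≤ b ≤ n, 1 ≤ a ≤ b and gcd a b ≡ 1 : exactly the reduced fractions
-- a/b with 0 < a/b ≤ 1 and denominator at most n (each listed once, in
-- lowest terms).
farey : ℕ → List (ℕ × ℕ)
farey n =
  filter (λ ab → gcd (proj₁ ab) (Data.Product.proj₂ ab) ≟ 1)
    (concatMap (λ b → map (λ a → (a , b)) (range1 b)) (range1 n))

𝒩 : ℕ → ℕ → ℕ
𝒩 n h = length (filter (λ ab → proj₁ ab ≟ h) (farey n))

-- For h = p^m with m > 0, a fraction h/b lies in F_n iff h < b ≤ n and p ∤ b. Since p ∣ h,
-- the admissible denominators b = h + j (1 ≤ j ≤ k, where k = n - h) are exactly those with
-- p ∤ j, whence 𝒩_n(h) · p = k (p - 1) + (k mod p). As the remainder lies in [0, p), this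
-- pins 𝒩_n(h) down as the ceiling of k (p - 1) / p.
module Submission where

open import Defs
open import Relation.Binary.PropositionalEquality

module Filter where

  open import Function.Base using (_∘_)
  open import Data.List.Base using (filter; map; _∷_; [])
  open import Data.List.Properties using (filter-accept; filter-reject)
  open import Relation.Nullary using (Dec; yes; no)
  open import Relation.Unary using (Pred; Decidable)

  module _ {a p q} {A : Set a} {P : Pred A p} {Q : Pred A q} (P? : Decidable P) (Q? : Decidable Q) where

    filter-comm : ∀ xs → filter P? (filter Q? xs) ≡ filter Q? (filter P? xs)
    filter-comm []       = refl
    filter-comm (x ∷ xs) = by-cases (P? x) (Q? x)
      where
      by-cases : Dec (P x) → Dec (Q x) → filter P? (filter Q? (x ∷ xs)) ≡ filter Q? (filter P? (x ∷ xs))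
      by-cases (yes px) (yes qx)
        rewrite filter-accept Q? {xs = xs} qx | filter-accept P? {xs = xs} px
              | filter-accept P? {xs = filter Q? xs} px | filter-accept Q? {xs = filter P? xs} qx
        = cong (x ∷_) (filter-comm xs)
      by-cases (yes px) (no ¬qx)
        rewrite filter-reject Q? {xs = xs} ¬qx | filter-accept P? {xs = xs} px
              | filter-reject Q? {xs = filter P? xs} ¬qx
        = filter-comm xs
      by-cases (no ¬px) (yes qx)
        rewrite filter-accept Q? {xs = xs} qx | filter-reject P? {xs = xs} ¬px
              | filter-reject P? {xs = filter Q? xs} ¬px
        = filter-comm xs
      by-cases (no ¬px) (no ¬qx)
        rewrite filter-reject Q? {xs = xs} ¬qx | filter-reject P? {xs = xs} ¬px
        = filter-comm xs

  module _ {a b p} {A : Set a} {B : Set b} {P : Pred B p} (P? : Decidable P) (f : A → B) where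

    filter-map : ∀ xs → filter P? (map f xs) ≡ map f (filter (P? ∘ f) xs)
    filter-map []       = refl
    filter-map (x ∷ xs) = by-cases (P? (f x))
      where
      by-cases : Dec (P (f x)) → filter P? (map f (x ∷ xs)) ≡ map f (filter (P? ∘ f) (x ∷ xs))
      by-cases (yes px) rewrite filter-accept P? {xs = map f xs} px | filter-accept (P? ∘ f) {xs = xs} px
        = cong (f x ∷_) (filter-map xs)
      by-cases (no ¬px) rewrite filter-reject P? {xs = map f xs} ¬px | filter-reject (P? ∘ f) {xs = xs} ¬px
        = filter-map xs

module FareyCount where

  open Filter
  open import Function.Base using (_∘_)
  open import Data.Nat.Base
    using (ℕ; zero; suc; _+_; _*_; _^_; _/_; _%_; _≤_; _<_; s≤s; s≤s⁻¹; NonZero; nonTrivial⇒n>1)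
  open import Data.Nat.Properties
    using ( _≟_; +-identityʳ; +-suc; m≤n⇒m<n∨m≡n; <⇒≢; <⇒≤; ≤-<-trans; <-≤-trans; ≤-refl; ≤-trans
          ; m≤m+n; n≤1+n; m≤m*n; m^n≢0)
  open import Data.Nat.Divisibility
    using (_∣_; _∣?_; ∣-refl; ∣-trans; ∣1⇒≡1; m∣m*n; ∣m+n∣m⇒∣n; ∣m∣n⇒∣m+n; m%n≡0⇒n∣m; n∣m⇒m%n≡0)
  open import Data.Nat.DivMod using (m≡m%n+[m/n]*n; [m+kn]%n≡m%n; m<n⇒m%n≡m; n%n≡0; m%n<n; %-pred-≡0)
  open import Data.Nat.GCD using (gcd; gcd-greatest)
  open import Data.Nat.Coprimality using (Coprime; coprime⇒gcd≡1; coprime-divisor; 1-coprimeTo)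
  open import Data.Nat.Primality using (Prime; prime⇒nonTrivial; prime⇒irreducible)
  open import Data.Nat.Tactic.RingSolver using (solve-∀)
  open import Data.List.Base using (List; []; _∷_; _++_; length; filter; map; concatMap)
  open import Data.List.Properties
    using (length-++; length-map; filter-++; concatMap-++; applyUpTo-∷ʳ; ++-identityʳ; filter-none; filter-accept; filter-reject)
  open import Data.List.Relation.Unary.All as All using (All)
  open import Data.List.Relation.Unary.All.Properties using (applyUpTo⁺₁; all-filter)
  open import Data.Product.Base using (_×_; _,_; proj₁; proj₂)
  open import Data.Sum.Base using (_⊎_; inj₁; inj₂)
  open import Relation.Nullary using (¬_; Dec; yes; no; contradiction)
  open ≡-Reasoning

  range1-∷ʳ : ∀ b → range1 (suc b) ≡ range1 b ++ suc b ∷ []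
  range1-∷ʳ b = sym (applyUpTo-∷ʳ suc b)

  filter-≟-range1-< : ∀ {h} b → b < h → filter (_≟ h) (range1 b) ≡ []
  filter-≟-range1-< {h} b b<h = filter-none (_≟ h) (applyUpTo⁺₁ suc b (λ i<b → <⇒≢ (≤-<-trans i<b b<h)))

  filter-≟-range1 : ∀ {h} b → 1 ≤ h → h ≤ b → filter (_≟ h) (range1 b) ≡ h ∷ []
  filter-≟-range1     zero    (s≤s _) ()
  filter-≟-range1 {h} (suc b) 1≤h h≤1+b = begin
    filter (_≟ h) (range1 (suc b))                            ≡⟨ cong (filter (_≟ h)) (range1-∷ʳ b) ⟩
    filter (_≟ h) (range1 b ++ suc b ∷ [])                    ≡⟨ filter-++ (_≟ h) (range1 b) (suc b ∷ []) ⟩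
    filter (_≟ h) (range1 b) ++ filter (_≟ h) (suc b ∷ [])   ≡⟨ by-cases (m≤n⇒m<n∨m≡n h≤1+b) ⟩
    h ∷ []                                                    ∎
    where
    by-cases : h < suc b ⊎ h ≡ suc b → filter (_≟ h) (range1 b) ++ filter (_≟ h) (suc b ∷ []) ≡ h ∷ []
    by-cases (inj₁ h<1+b) = cong₂ _++_ (filter-≟-range1 b 1≤h (s≤s⁻¹ h<1+b)) (filter-reject (_≟ h) (<⇒≢ h<1+b ∘ sym))
    by-cases (inj₂ refl)  = cong₂ _++_ (filter-≟-range1-< b ≤-refl) (filter-accept (_≟ h) refl)

  row : ℕ → List (ℕ × ℕ)
  row b = map (λ a → (a , b)) (range1 b)

  coprimeTo? : ∀ b a → Dec (gcd a b ≡ 1)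
  coprimeTo? b a = gcd a b ≟ 1

  reduced? : (ab : ℕ × ℕ) → Dec (gcd (proj₁ ab) (proj₂ ab) ≡ 1)
  reduced? (a , b) = coprimeTo? b a

  numerator≟ : ∀ h (ab : ℕ × ℕ) → Dec (proj₁ ab ≡ h)
  numerator≟ h ab = proj₁ ab ≟ h

  -- 𝒩 n h unfolds definitionally to numeratorCount h (concatMap row (range1 n)).
  numeratorCount : ℕ → List (ℕ × ℕ) → ℕ
  numeratorCount h xs = length (filter (numerator≟ h) (filter reduced? xs))

  numeratorCount-++ : ∀ h xs ys → numeratorCount h (xs ++ ys) ≡ numeratorCount h xs + numeratorCount h ys
  numeratorCount-++ h xs ys = begin
    length (filter (numerator≟ h) (filter reduced? (xs ++ ys)))
      ≡⟨ cong (length ∘ filter (numerator≟ h)) (filter-++ reduced? xs ys) ⟩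
    length (filter (numerator≟ h) (filter reduced? xs ++ filter reduced? ys))
      ≡⟨ cong length (filter-++ (numerator≟ h) (filter reduced? xs) (filter reduced? ys)) ⟩
    length (filter (numerator≟ h) (filter reduced? xs) ++ filter (numerator≟ h) (filter reduced? ys))
      ≡⟨ length-++ (filter (numerator≟ h) (filter reduced? xs)) ⟩
    numeratorCount h xs + numeratorCount h ys ∎

  rowCount : ℕ → ℕ → ℕ
  rowCount h b = length (filter (coprimeTo? b) (filter (_≟ h) (range1 b)))

  numeratorCount-row : ∀ h b → numeratorCount h (row b) ≡ rowCount h b
  numeratorCount-row h b = begin
    length (filter (numerator≟ h) (filter reduced? (map pair (range1 b))))
      ≡⟨ cong (length ∘ filter (numerator≟ h)) (filter-map reduced? pair (range1 b)) ⟩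
    length (filter (numerator≟ h) (map pair (filter (coprimeTo? b) (range1 b))))
      ≡⟨ cong length (filter-map (numerator≟ h) pair (filter (coprimeTo? b) (range1 b))) ⟩
    length (map pair (filter (_≟ h) (filter (coprimeTo? b) (range1 b))))
      ≡⟨ length-map pair (filter (_≟ h) (filter (coprimeTo? b) (range1 b))) ⟩
    length (filter (_≟ h) (filter (coprimeTo? b) (range1 b)))
      ≡⟨ cong length (filter-comm (_≟ h) (coprimeTo? b) (range1 b)) ⟩
    rowCount h b ∎
    where
    pair : ℕ → ℕ × ℕ
    pair a = (a , b)

  rowCount-coprime : ∀ {h b} → 1 ≤ h → h ≤ b → gcd h b ≡ 1 → rowCount h b ≡ 1
  rowCount-coprime {h} {b} 1≤h h≤b coprime = begin
    length (filter (coprimeTo? b) (filter (_≟ h) (range1 b))) ≡⟨ cong (length ∘ filter (coprimeTo? b)) (filter-≟-range1 b 1≤h h≤b) ⟩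
    length (filter (coprimeTo? b) (h ∷ []))                   ≡⟨ cong length (filter-accept (coprimeTo? b) {x = h} {xs = []} coprime) ⟩
    1                                                         ∎

  rowCount-¬coprime : ∀ {h b} → gcd h b ≢ 1 → rowCount h b ≡ 0
  rowCount-¬coprime {h} {b} ¬coprime = cong length (filter-none (coprimeTo? b) only-h)
    where
    only-h : All (λ a → gcd a b ≢ 1) (filter (_≟ h) (range1 b))
    only-h = All.map (λ { refl → ¬coprime }) (all-filter (_≟ h) (range1 b))

  rowCount-< : ∀ {h b} → b < h → rowCount h b ≡ 0
  rowCount-< {h} {b} b<h = cong (length ∘ filter (coprimeTo? b)) (filter-≟-range1-< b b<h)

  𝒩-suc : ∀ n h → 𝒩 (suc n) h ≡ 𝒩 n h + rowCount h (suc n)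
  𝒩-suc n h = begin
    numeratorCount h (concatMap row (range1 (suc n)))                  ≡⟨ cong (numeratorCount h ∘ concatMap row) (range1-∷ʳ n) ⟩
    numeratorCount h (concatMap row (range1 n ++ suc n ∷ []))          ≡⟨ cong (numeratorCount h) (concatMap-++ row (range1 n) (suc n ∷ [])) ⟩
    numeratorCount h (concatMap row (range1 n) ++ row (suc n) ++ [])   ≡⟨ numeratorCount-++ h (concatMap row (range1 n)) (row (suc n) ++ []) ⟩
    𝒩 n h + numeratorCount h (row (suc n) ++ [])                       ≡⟨ cong (λ xs → 𝒩 n h + numeratorCount h xs) (++-identityʳ (row (suc n))) ⟩
    𝒩 n h + numeratorCount h (row (suc n))                             ≡⟨ cong (𝒩 n h +_) (numeratorCount-row h (suc n)) ⟩
    𝒩 n h + rowCount h (suc n)                                         ∎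

  𝒩-suc-coprime : ∀ {n h} → 1 ≤ h → h ≤ suc n → gcd h (suc n) ≡ 1 → 𝒩 (suc n) h ≡ 𝒩 n h + 1
  𝒩-suc-coprime {n} {h} 1≤h h≤1+n coprime = trans (𝒩-suc n h) (cong (𝒩 n h +_) (rowCount-coprime {h} {suc n} 1≤h h≤1+n coprime))

  𝒩-suc-¬coprime : ∀ {n h} → gcd h (suc n) ≢ 1 → 𝒩 (suc n) h ≡ 𝒩 n h
  𝒩-suc-¬coprime {n} {h} ¬coprime =
    trans (𝒩-suc n h) (trans (cong (𝒩 n h +_) (rowCount-¬coprime {h} {suc n} ¬coprime)) (+-identityʳ (𝒩 n h)))

  𝒩-suc-< : ∀ {n h} → suc n < h → 𝒩 (suc n) h ≡ 𝒩 n h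
  𝒩-suc-< {n} {h} 1+n<h =
    trans (𝒩-suc n h) (trans (cong (𝒩 n h +_) (rowCount-< {h} {suc n} 1+n<h)) (+-identityʳ (𝒩 n h)))

  gcd≢1 : ∀ {d m n} → 1 < d → d ∣ m → d ∣ n → gcd m n ≢ 1
  gcd≢1 1<d d∣m d∣n gcd≡1 = <⇒≢ 1<d (sym (∣1⇒≡1 (subst (_ ∣_) gcd≡1 (gcd-greatest d∣m d∣n))))

  -- h/b ≤ 1 forces h ≤ b, and h/h is not reduced when h > 1.
  𝒩-≤ : ∀ {n h} → 1 < h → n ≤ h → 𝒩 n h ≡ 0
  𝒩-≤ {zero}        _   _     = refl
  𝒩-≤ {suc n} {h} 1<h 1+n≤h = trans (drop-row (m≤n⇒m<n∨m≡n 1+n≤h)) (𝒩-≤ 1<h (<⇒≤ 1+n≤h))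
    where
    drop-row : suc n < h ⊎ suc n ≡ h → 𝒩 (suc n) h ≡ 𝒩 n h
    drop-row (inj₁ 1+n<h) = 𝒩-suc-< 1+n<h
    drop-row (inj₂ refl)  = 𝒩-suc-¬coprime {n} {h} (gcd≢1 1<h ∣-refl ∣-refl)

  coprime-*ˡ : ∀ {a b c} → Coprime a c → Coprime b c → Coprime (a * b) c
  coprime-*ˡ {a} a⊥c b⊥c {d} (d∣ab , d∣c) = b⊥c (coprime-divisor d⊥a d∣ab , d∣c)
    where
    d⊥a : Coprime d a
    d⊥a (e∣d , e∣a) = a⊥c (e∣a , ∣-trans e∣d d∣c)

  module _ {p} (prime : Prime p) where

    ∤⇒coprime : ∀ {n} → ¬ p ∣ n → Coprime p n
    ∤⇒coprime {n} p∤n {d} (d∣p , d∣n) with prime⇒irreducible prime d∣p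
    ... | inj₁ d≡1 = d≡1
    ... | inj₂ d≡p = contradiction (subst (_∣ n) d≡p d∣n) p∤n

    ∤⇒coprime-^ : ∀ m {n} → ¬ p ∣ n → Coprime (p ^ m) n
    ∤⇒coprime-^ zero    _   = 1-coprimeTo _
    ∤⇒coprime-^ (suc m) p∤n = coprime-*ˡ (∤⇒coprime p∤n) (∤⇒coprime-^ m p∤n)

  suc-% : ∀ k d .{{_ : NonZero d}} → ¬ d ∣ suc k → suc k % d ≡ suc (k % d)
  suc-% k d d∤1+k = by-cases (m≤n⇒m<n∨m≡n (m%n<n k d))
    where
    %-shift : suc k % d ≡ suc (k % d) % d
    %-shift = trans (cong (λ x → suc x % d) (m≡m%n+[m/n]*n k d)) ([m+kn]%n≡m%n (suc (k % d)) (k / d) d)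
    by-cases : suc (k % d) < d ⊎ suc (k % d) ≡ d → suc k % d ≡ suc (k % d)
    by-cases (inj₁ 1+r<d) = trans %-shift (m<n⇒m%n≡m 1+r<d)
    by-cases (inj₂ 1+r≡d) = contradiction (m%n≡0⇒n∣m (suc k) d (trans %-shift (trans (cong (_% d) 1+r≡d) (n%n≡0 d)))) d∤1+k

  module PrimePowerNumerator {q} (prime : Prime (suc q)) (m : ℕ) where

    p h : ℕ
    p = suc q
    h = p ^ suc m

    1<p : 1 < p
    1<p = nonTrivial⇒n>1 p {{prime⇒nonTrivial prime}}

    p∣h : p ∣ h
    p∣h = m∣m*n (p ^ m)

    1<h : 1 < h
    1<h = <-≤-trans 1<p (m≤m*n p (p ^ m) {{m^n≢0 p m}})

    𝒩[h+k]*p : ∀ k → 𝒩 (h + k) h * p ≡ k * q + k % p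
    𝒩[h+k]*p zero = begin
      𝒩 (h + 0) h * p ≡⟨ cong (λ n → 𝒩 n h * p) (+-identityʳ h) ⟩
      𝒩 h h * p       ≡⟨ cong (_* p) (𝒩-≤ 1<h ≤-refl) ⟩
      0               ∎
    𝒩[h+k]*p (suc k) with p ∣? suc k
    ... | yes p∣1+k = begin
      𝒩 (h + suc k) h * p   ≡⟨ cong (λ n → 𝒩 n h * p) (+-suc h k) ⟩
      𝒩 (suc (h + k)) h * p ≡⟨ cong (_* p) (𝒩-suc-¬coprime {h + k} {h} (gcd≢1 1<p p∣h p∣h+1+k)) ⟩
      𝒩 (h + k) h * p       ≡⟨ 𝒩[h+k]*p k ⟩
      k * q + k % p         ≡⟨ cong (k * q +_) (%-pred-≡0 1+k%p≡0) ⟩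
      k * q + q             ≡⟨ step k q ⟩
      suc k * q + 0         ≡⟨ cong (suc k * q +_) 1+k%p≡0 ⟨
      suc k * q + suc k % p ∎
      where
      1+k%p≡0 : suc k % p ≡ 0
      1+k%p≡0 = n∣m⇒m%n≡0 (suc k) p p∣1+k
      p∣h+1+k : p ∣ suc (h + k)
      p∣h+1+k = subst (p ∣_) (+-suc h k) (∣m∣n⇒∣m+n p∣h p∣1+k)
      step : ∀ k q → k * q + q ≡ (1 + k) * q + 0
      step = solve-∀
    ... | no p∤1+k = begin
      𝒩 (h + suc k) h * p     ≡⟨ cong (λ n → 𝒩 n h * p) (+-suc h k) ⟩
      𝒩 (suc (h + k)) h * p   ≡⟨ cong (_* p) (𝒩-suc-coprime (<⇒≤ 1<h) h≤h+1+k h⊥h+1+k) ⟩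
      (𝒩 (h + k) h + 1) * p   ≡⟨ add-one (𝒩 (h + k) h) q ⟩
      𝒩 (h + k) h * p + p     ≡⟨ cong (_+ p) (𝒩[h+k]*p k) ⟩
      k * q + k % p + p       ≡⟨ step k q (k % p) ⟩
      suc k * q + suc (k % p) ≡⟨ cong (suc k * q +_) (suc-% k p p∤1+k) ⟨
      suc k * q + suc k % p   ∎
      where
      h≤h+1+k : h ≤ suc (h + k)
      h≤h+1+k = ≤-trans (m≤m+n h k) (n≤1+n (h + k))
      p∤h+1+k : ¬ p ∣ suc (h + k)
      p∤h+1+k p∣ = p∤1+k (∣m+n∣m⇒∣n (subst (p ∣_) (sym (+-suc h k)) p∣) p∣h)
      h⊥h+1+k : gcd h (suc (h + k)) ≡ 1
      h⊥h+1+k = coprime⇒gcd≡1 (∤⇒coprime-^ prime (suc m) p∤h+1+k)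
      add-one : ∀ t q → (t + 1) * (1 + q) ≡ t * (1 + q) + (1 + q)
      add-one = solve-∀
      step : ∀ k q r → k * q + r + (1 + q) ≡ (1 + k) * q + (1 + r)
      step = solve-∀

module Ceiling where

  open import Data.Nat.Base as ℕ using (suc)
  import Data.Nat.Properties as ℕ
  open import Data.Integer.Base as ℤ using (+_; _+_; _*_; -_; _≤_; _<_)
  import Data.Integer.Properties as ℤ
  open import Data.Integer.DivMod using (_/_; [n/d]*d≤n; n<s[n/ℕd]*d; div-pos-is-/ℕ)
  open import Data.Integer.Tactic.RingSolver using (solve-∀)
  open import Data.Rational.Base as ℚ using (mkℚ; ↥_; ↧_; floor; ceiling; toℚᵘ; 1ℚ)
  import Data.Rational.Properties as ℚ
  open import Data.Rational.Unnormalised.Base as ℚᵘ using (mkℚᵘ; *≡*) renaming (_≃_ to _≃ᵘ_)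
  import Data.Rational.Unnormalised.Properties as ℚᵘ

  /-unique : ∀ n z d → z * + suc d ≤ n → n < ℤ.suc z * + suc d → n / + suc d ≡ z
  /-unique n z d lo hi = ℤ.≤-antisym (below n/D-lo hi) (below lo n/D-hi)
    where
    D = + suc d
    below : ∀ {x y} → x * D ≤ n → n < ℤ.suc y * D → x ≤ y
    below {x} {y} xD≤n n<[y+1]D = subst (x ≤_) (ℤ.pred-suc y)
      (ℤ.i<j⇒i≤pred[j] {x} {ℤ.suc y} (ℤ.*-cancelʳ-<-nonNeg {x} {ℤ.suc y} D (ℤ.≤-<-trans xD≤n n<[y+1]D)))
    n/D-lo : (n / D) * D ≤ n
    n/D-lo = [n/d]*d≤n n D
    n/D-hi : n < ℤ.suc (n / D) * D
    n/D-hi = subst (λ w → n < ℤ.suc w * D) (sym (div-pos-is-/ℕ n (suc d))) (n<s[n/ℕd]*d n (suc d))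

  floor-unique : ∀ r z → z * ↧ r ≤ ↥ r → ↥ r < ℤ.suc z * ↧ r → floor r ≡ z
  floor-unique (mkℚ n d _) z = /-unique n z d

  ceiling-unique : ∀ r z → ↥ r ≤ z * ↧ r → z * ↧ r < ↥ r + ↧ r → ceiling r ≡ z
  ceiling-unique r@(mkℚ n d _) z n≤zD zD<n+D = begin
    - floor (ℚ.- r) ≡⟨ cong -_ (floor-unique (ℚ.- r) (- z) lo hi) ⟩
    - - z           ≡⟨ ℤ.neg-involutive z ⟩
    z               ∎
    where
    open ≡-Reasoning
    D = + suc d
    lo : - z * ↧ (ℚ.- r) ≤ ↥ (ℚ.- r)
    lo = subst₂ _≤_ (trans (ℤ.neg-distribˡ-* z D) (cong (- z *_) (sym (ℚ.↧-neg r)))) (sym (ℚ.↥-neg r)) (ℤ.neg-mono-≤ n≤zD)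
    hi : ↥ (ℚ.- r) < ℤ.suc (- z) * ↧ (ℚ.- r)
    hi = subst₂ _<_ (trans (cancel n D) (sym (ℚ.↥-neg r))) (trans (shift z D) (cong (ℤ.suc (- z) *_) (sym (ℚ.↧-neg r))))
      (ℤ.+-monoˡ-< D (ℤ.neg-mono-< zD<n+D))
      where
      cancel : ∀ n D → - (n + D) + D ≡ - n
      cancel = solve-∀
      shift : ∀ z D → - (z * D) + D ≡ (+ 1 + - z) * D
      shift = solve-∀

  ceiling-≃ᵘ : ∀ r c d t → toℚᵘ r ≃ᵘ mkℚᵘ (+ c) d → c ℕ.≤ t ℕ.* suc d → t ℕ.* suc d ℕ.< c ℕ.+ suc d → ceiling r ≡ + t
  ceiling-≃ᵘ r@(mkℚ n e _) c d t (*≡* nS≡CE) c≤tS tS<c+S = ceiling-unique r T n≤TE TE<n+E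
    where
    open ℤ.≤-Reasoning
    S = + suc d
    E = + suc e
    C = + c
    T = + t
    reorder : ∀ a b c → a * b * c ≡ a * c * b
    reorder = solve-∀
    distrib : ∀ a b c → (a + b) * c ≡ a * c + b * c
    distrib = solve-∀
    n≤TE : n ≤ T * E
    n≤TE = ℤ.*-cancelʳ-≤-pos n (T * E) S (begin
      n * S     ≡⟨ nS≡CE ⟩
      C * E     ≤⟨ ℤ.*-monoʳ-≤-nonNeg E (subst (C ≤_) (ℤ.pos-* t (suc d)) (ℤ.+≤+ c≤tS)) ⟩
      T * S * E ≡⟨ reorder T S E ⟩
      T * E * S ∎)
    TE<n+E : T * E < n + E
    TE<n+E = ℤ.*-cancelʳ-<-nonNeg {T * E} {n + E} S (begin-strict
      T * E * S     ≡⟨ reorder T E S ⟩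
      T * S * E     <⟨ ℤ.*-monoʳ-<-pos E (subst₂ _<_ (ℤ.pos-* t (suc d)) (ℤ.pos-+ c (suc d)) (ℤ.+<+ tS<c+S)) ⟩
      (C + S) * E   ≡⟨ distrib C S E ⟩
      C * E + S * E ≡⟨ cong₂ _+_ (sym nS≡CE) (ℤ.*-comm S E) ⟩
      n * S + E * S ≡⟨ sym (distrib n E S) ⟩
      (n + E) * S   ∎)

  toℚᵘ-/ : ∀ i n → toℚᵘ (i ℚ./ suc n) ≃ᵘ mkℚᵘ i n
  toℚᵘ-/ i n = ℚ.toℚᵘ-fromℚᵘ (mkℚᵘ i n)

  toℚᵘ-*[1-1/[1+q]] : ∀ x q → toℚᵘ ((x ℚ./ 1) ℚ.* (1ℚ ℚ.- + 1 ℚ./ suc q)) ≃ᵘ mkℚᵘ (x * + q) q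
  toℚᵘ-*[1-1/[1+q]] x q = begin
    toℚᵘ ((x ℚ./ 1) ℚ.* (1ℚ ℚ.- + 1 ℚ./ suc q))
      ≈⟨ ℚ.toℚᵘ-homo-* (x ℚ./ 1) (1ℚ ℚ.- + 1 ℚ./ suc q) ⟩
    toℚᵘ (x ℚ./ 1) ℚᵘ.* toℚᵘ (1ℚ ℚ.- + 1 ℚ./ suc q)
      ≈⟨ ℚᵘ.*-cong (toℚᵘ-/ x 0) (ℚ.toℚᵘ-homo-+ 1ℚ (ℚ.- (+ 1 ℚ./ suc q))) ⟩
    mkℚᵘ x 0 ℚᵘ.* (mkℚᵘ (+ 1) 0 ℚᵘ.+ toℚᵘ (ℚ.- (+ 1 ℚ./ suc q)))
      ≈⟨ ℚᵘ.*-congˡ {mkℚᵘ x 0} (ℚᵘ.+-congʳ (mkℚᵘ (+ 1) 0) neg-unit) ⟩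
    mkℚᵘ x 0 ℚᵘ.* (mkℚᵘ (+ 1) 0 ℚᵘ.- mkℚᵘ (+ 1) q)
      ≈⟨ *≡* (cong₂ (λ a b → x * + a * + suc b) (ℕ.+-identityʳ q) (sym q+0+0≡q)) ⟩
    mkℚᵘ (x * + q) q ∎
    where
    open ℚᵘ.≃-Reasoning
    neg-unit : toℚᵘ (ℚ.- (+ 1 ℚ./ suc q)) ≃ᵘ ℚᵘ.- mkℚᵘ (+ 1) q
    neg-unit = ℚᵘ.≃-trans (ℚ.toℚᵘ-homo‿- (+ 1 ℚ./ suc q)) (ℚᵘ.-‿cong (toℚᵘ-/ (+ 1) q))
    -- ℚᵘ arithmetic leaves the ℕ denominators as q + 0 and q + 0 + 0.
    q+0+0≡q : q ℕ.+ 0 ℕ.+ 0 ≡ q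
    q+0+0≡q = trans (ℕ.+-identityʳ (q ℕ.+ 0)) (ℕ.+-identityʳ q)

  ceiling-*[1-1/[1+q]] : ∀ k q t r → t ℕ.* suc q ≡ k ℕ.* q ℕ.+ r → r ℕ.< suc q →
                         ceiling ((+ k ℚ./ 1) ℚ.* (1ℚ ℚ.- + 1 ℚ./ suc q)) ≡ + t
  ceiling-*[1-1/[1+q]] k q t r t[1+q]≡kq+r r<1+q = ceiling-≃ᵘ _ (k ℕ.* q) q t value lower upper
    where
    value : toℚᵘ ((+ k ℚ./ 1) ℚ.* (1ℚ ℚ.- + 1 ℚ./ suc q)) ≃ᵘ mkℚᵘ (+ (k ℕ.* q)) q
    value = subst (λ c → toℚᵘ ((+ k ℚ./ 1) ℚ.* (1ℚ ℚ.- + 1 ℚ./ suc q)) ≃ᵘ mkℚᵘ c q)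
                  (sym (ℤ.pos-* k q)) (toℚᵘ-*[1-1/[1+q]] (+ k) q)
    lower : k ℕ.* q ℕ.≤ t ℕ.* suc q
    lower = subst (k ℕ.* q ℕ.≤_) (sym t[1+q]≡kq+r) (ℕ.m≤m+n (k ℕ.* q) r)
    upper : t ℕ.* suc q ℕ.< k ℕ.* q ℕ.+ suc q
    upper = subst (ℕ._< k ℕ.* q ℕ.+ suc q) (sym t[1+q]≡kq+r) (ℕ.+-monoʳ-< (k ℕ.* q) r<1+q)

open import Data.Nat using (ℕ; _^_; _<_)
open import Data.Nat.Primality using (Prime; prime⇒nonZero)
open import Data.Integer using (ℤ; +_; _-_)
open import Data.Rational using (ℚ; _/_; 1ℚ; _*_; ceiling) renaming (_-_ to _-ℚ_)

open import Data.Nat.Base using (zero; suc; _+_; _∸_)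
open import Data.Nat.Properties using (m+[n∸m]≡n; <⇒≤)
open import Data.Nat.DivMod using (m%n<n)
open import Data.Nat.Primality using (¬prime[0])
open import Data.Integer.Properties using (m-n≡m⊖n; ⊖-≥)
open import Relation.Nullary using (contradiction)
open FareyCount using (module PrimePowerNumerator)
open Ceiling using (ceiling-*[1-1/[1+q]])

corollary1 : (p m n : ℕ) → (pr : Prime p) → 0 < m → 0 < p ^ m → p ^ m < n →
    + 𝒩 n (p ^ m)
      ≡ ceiling ((((+ n) - (+ (p ^ m))) / 1) * (1ℚ -ℚ (_/_ (+ 1) p {{prime⇒nonZero pr}})))
corollary1 zero    _        _ pr _  _ _   = contradiction pr ¬prime[0]
corollary1 (suc q) zero     _ _  () _ _
corollary1 (suc q) (suc m′) n pr _  _ h<n = begin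
  + 𝒩 n h                                             ≡⟨ cong (λ j → + 𝒩 j h) (m+[n∸m]≡n (<⇒≤ h<n)) ⟨
  + 𝒩 (h + k) h                                       ≡⟨ ceiling-*[1-1/[1+q]] k q _ _ (𝒩[h+k]*p k) (m%n<n k p) ⟨
  ceiling ((+ k / 1) * (1ℚ -ℚ (+ 1 / p)))             ≡⟨ cong (λ x → ceiling ((x / 1) * (1ℚ -ℚ (+ 1 / p)))) n-h≡k ⟨
  ceiling ((((+ n) - (+ h)) / 1) * (1ℚ -ℚ (+ 1 / p))) ∎
  where
  open ≡-Reasoning
  open PrimePowerNumerator pr m′
  k : ℕ
  k = n ∸ h
  n-h≡k : (+ n) - (+ h) ≡ + k
  n-h≡k = trans (m-n≡m⊖n n h) (⊖-≥ (<⇒≤ h<n))
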